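{- Let $\mathcal{M}$ be the set of Motzkin meanders that contain neither $DH$ nor $HD$ as a contiguous subword, and let $S(u)=S(u,z)=\sum_{w\in\mathcal{M}} z^{|w|}u^{\mathrm{level}(w)}$. Put $$W=\sqrt{(1+z-2z^2-z^3)(1-3z+2z^2-z^3)},\qquad r_1=\frac{1-z+z^3-W}{2z}.$$ Then $$S(u)=\frac{r_1}{z(1-z-ur_1)},$$ so that the generating function of excursions is $S(0)=\frac{r_1}{z(1-z)}$, and for every $j\ge 0$ the generating function of the meanders in $\mathcal{M}$ ending at level $j$ is $[u^j]S(u)=\frac1z\Big(\frac{r_1}{1-z}\Big)^{j+1}$.
   Context: A Motzkin meander is a finite word $w$ over the alphabet $\{U,H,D\}$, where $U,H,D$ have heights $+1,0,-1$ respectively, such that every prefix of $w$ has nonnegative height sum; $|w|$ is its length and $\mathrm{level}(w)$ is the total height sum (the final altitude). The empty word is included. A Motzkin excursion is a meander ending at level $0$. "Contains $XY$ as a contiguous subword" means two consecutive letters of $w$ are $X$ followed by $Y$. All generating functions are formal power series in $z$ (with coefficients polynomial in $u$); the square root $W$ denotes the formal power series with constant term $1$ whose square is the given polynomial, and $[u^j]$ extracts the coefficient of $u^j$. -}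

module Defs where

open import Data.Nat as ℕ using (ℕ; zero; suc; _∸_)
open import Data.Integer as ℤ using (ℤ; +_; 0ℤ; 1ℤ; _≥_)
open import Data.Bool using (Bool; true; false; _∧_; _∨_; not)
open import Data.List using (List; []; _∷_; length; filter; map; concatMap)
open import Relation.Nullary.Decidable using (⌊_⌋)
open import Relation.Binary.PropositionalEquality using (_≡_)

data Letter : Set where
  U H D : Letter

height : Letter → ℤ
height U = + 1
height H = 0ℤ
height D = ℤ.- (+ 1)

level : List Letter → ℤ
level []      = 0ℤ
level (x ∷ w) = height x ℤ.+ level w

prefixesNonneg : ℤ → List Letter → Bool
prefixesNonneg a []      = true
prefixesNonneg a (x ∷ w) = ⌊ 0ℤ ℤ.≤? (a ℤ.+ height x) ⌋ ∧ prefixesNonneg (a ℤ.+ height x) w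

isMeander : List Letter → Bool
isMeander w = prefixesNonneg 0ℤ w

containsPair : Letter → Letter → List Letter → Bool
containsPair X Y []            = false
containsPair X Y (_ ∷ [])      = false
containsPair X Y (a ∷ b ∷ w)   = eqPair X Y a b ∨ containsPair X Y (b ∷ w)
  where
  eqL : Letter → Letter → Bool
  eqL U U = true
  eqL H H = true
  eqL D D = true
  eqL _ _ = false
  eqPair : Letter → Letter → Letter → Letter → Bool
  eqPair X Y a b = eqL X a ∧ eqL Y b

inM : List Letter → Bool
inM w = isMeander w ∧ not (containsPair D H w) ∧ not (containsPair H D w)

words : ℕ → List (List Letter)
words zero    = [] ∷ []
words (suc n) = concatMap (λ w → (U ∷ w) ∷ (H ∷ w) ∷ (D ∷ w) ∷ []) (words n)

countBy : {A : Set} → (A → Bool) → List A → ℕ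
countBy p []       = zero
countBy p (x ∷ xs) with p x
... | true  = suc (countBy p xs)
... | false = countBy p xs

count : ℕ → ℕ → ℕ
count n j = countBy (λ w → inM w ∧ ⌊ level w ℤ.≟ + j ⌋) (words n)

PS : Set
PS = ℕ → ℤ

_≈_ : PS → PS → Set
f ≈ g = ∀ n → f n ≡ g n
infix 4 _≈_

sumTo : ℕ → (ℕ → ℤ) → ℤ
sumTo zero    h = h zero
sumTo (suc n) h = sumTo n h ℤ.+ h (suc n)

const : ℤ → PS
const c zero    = c
const c (suc n) = 0ℤ

z : PS
z 1 = 1ℤ
z _ = 0ℤ

_⊕_ : PS → PS → PS
(f ⊕ g) n = f n ℤ.+ g n

_⊖_ : PS → PS → PS
(f ⊖ g) n = f n ℤ.- g n

_⊛_ : PS → PS → PS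
(f ⊛ g) n = sumTo n (λ k → f k ℤ.* g (n ∸ k))

infixl 7 _⊛_
infixl 6 _⊕_ _⊖_

_^ˢ_ : PS → ℕ → PS
f ^ˢ zero  = const 1ℤ
f ^ˢ suc k = f ⊛ (f ^ˢ k)

P : PS
P = (const 1ℤ ⊕ z ⊖ const (+ 2) ⊛ z ^ˢ 2 ⊖ z ^ˢ 3)
  ⊛ (const 1ℤ ⊖ const (+ 3) ⊛ z ⊕ const (+ 2) ⊛ z ^ˢ 2 ⊖ z ^ˢ 3)

-- Series in z with coefficients polynomial in u: family indexed by the
-- power of u (the u^j-coefficient is a series in z)

BS : Set
BS = ℕ → PS

_≈₂_ : BS → BS → Set
A ≈₂ B = ∀ j → A j ≈ B j
infix 4 _≈₂_

ι : PS → BS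
ι f zero    = f
ι f (suc j) = const 0ℤ

u : BS
u 1 = const 1ℤ
u _ = const 0ℤ

_⊕₂_ : BS → BS → BS
(A ⊕₂ B) j = A j ⊕ B j

_⊖₂_ : BS → BS → BS
(A ⊖₂ B) j = A j ⊖ B j

_⊛₂_ : BS → BS → BS
(A ⊛₂ B) j n = sumTo j (λ i → (A i ⊛ B (j ∸ i)) n)

infixl 7 _⊛₂_
infixl 6 _⊕₂_ _⊖₂_

S : BS
S j n = + count n j

-- Read a word with an automaton whose states record the altitude and the last letter;
-- membership in 𝓜 becomes a condition on the final state. Sorting the words of 𝓜 of
-- level j by their last letter gives three counts obeying a linear recursion: a word
-- ending in U extends any word one level lower, one ending in H extends a word ending in
-- U or H at the same level, one ending in D extends a word ending in U or D one level
-- higher. Because r₁ = zρ is the root of z r² − (1 − z + z³) r + z(1 − z) vanishing at 0,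
-- the series T^j, z T^j/(1 − z) and (ρ − 1) T^j/(1 − z), with T = r₁/(1 − z), solve the
-- same recursion, so induction on the length identifies them with the counts. Summing,
-- [u^j] S = ρ T^j/(1 − z) = (1/z) T^(j+1), and the kernel equation holds coefficientwise in u.

module Submission where

open import Defs
open import Data.Nat using (ℕ; suc)
open import Data.Integer using (1ℤ; +_)
open import Data.Product using (_×_; _,_)
open import Relation.Binary.PropositionalEquality using (_≡_)

module PowerSeries where

  open import Level using (0ℓ)
  open import Data.Nat as ℕ using (ℕ; zero; suc; _∸_; z≤n)
  import Data.Nat.Properties as ℕP
  open import Data.Integer as ℤ using (ℤ; 0ℤ; 1ℤ; _+_; _*_; -_; _-_)
  import Data.Integer.Properties as ℤP
  open import Data.Integer.Solver using (module +-*-Solver)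
  open import Algebra.Properties.CommutativeSemigroup ℤP.+-commutativeSemigroup using (interchange)
  open import Data.Maybe using (Maybe; just; nothing)
  open import Data.Product using (_,_)
  open import Relation.Nullary using (yes; no)
  open import Relation.Binary.PropositionalEquality
    using (_≡_; refl; cong; cong₂; sym; trans; module ≡-Reasoning)
  open import Algebra.Bundles using (CommutativeRing)
  open import Algebra.Solver.Ring.AlmostCommutativeRing
    using (fromCommutativeRing; _-Raw-AlmostCommutative⟶_)
  import Algebra.Solver.Ring
  open ≡-Reasoning

  sumTo-cong : ∀ n {h g : ℕ → ℤ} → (∀ k → k ℕ.≤ n → h k ≡ g k) → sumTo n h ≡ sumTo n g
  sumTo-cong zero    h≡g = h≡g 0 z≤n
  sumTo-cong (suc n) h≡g =
    cong₂ _+_ (sumTo-cong n (λ k k≤n → h≡g k (ℕP.m≤n⇒m≤1+n k≤n))) (h≡g (suc n) ℕP.≤-refl)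

  sumTo-+ : ∀ n (h g : ℕ → ℤ) → sumTo n (λ k → h k + g k) ≡ sumTo n h + sumTo n g
  sumTo-+ zero    h g = refl
  sumTo-+ (suc n) h g = trans (cong (_+ (h (suc n) + g (suc n))) (sumTo-+ n h g))
                              (interchange (sumTo n h) (sumTo n g) (h (suc n)) (g (suc n)))

  sumTo-*ˡ : ∀ n c (h : ℕ → ℤ) → sumTo n (λ k → c * h k) ≡ c * sumTo n h
  sumTo-*ˡ zero    c h = refl
  sumTo-*ˡ (suc n) c h = trans (cong (_+ c * h (suc n)) (sumTo-*ˡ n c h))
                                (sym (ℤP.*-distribˡ-+ c (sumTo n h) (h (suc n))))

  sumTo-zero : ∀ n {h : ℕ → ℤ} → (∀ k → h k ≡ 0ℤ) → sumTo n h ≡ 0ℤ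
  sumTo-zero zero    h≡0 = h≡0 0
  sumTo-zero (suc n) h≡0 = trans (cong₂ _+_ (sumTo-zero n h≡0) (h≡0 (suc n))) refl

  sumTo-unfoldˡ : ∀ n (h : ℕ → ℤ) → sumTo (suc n) h ≡ h 0 + sumTo n (λ k → h (suc k))
  sumTo-unfoldˡ zero    h = refl
  sumTo-unfoldˡ (suc n) h = trans (cong (_+ h (suc (suc n))) (sumTo-unfoldˡ n h))
                                   (ℤP.+-assoc (h 0) _ _)

  sumTo-two : ∀ n (h : ℕ → ℤ) → (∀ k → h (suc (suc k)) ≡ 0ℤ) → sumTo (suc n) h ≡ h 0 + h 1
  sumTo-two zero    h h≡0 = refl
  sumTo-two (suc n) h h≡0 = trans (cong₂ _+_ (sumTo-two n h h≡0) (h≡0 n)) (ℤP.+-identityʳ _)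

  shift : PS → PS
  shift f n = f (suc n)

  𝟘 𝟙 : PS
  𝟘 = const 0ℤ
  𝟙 = const 1ℤ

  const-zero : ∀ n → 𝟘 n ≡ 0ℤ
  const-zero zero    = refl
  const-zero (suc n) = refl

  ⊛-unfoldˡ : ∀ n (f g : PS) → (f ⊛ g) (suc n) ≡ f 0 * g (suc n) + (shift f ⊛ g) n
  ⊛-unfoldˡ n f g = sumTo-unfoldˡ n (λ k → f k * g (suc n ∸ k))

  ⊛-unfoldʳ : ∀ n (f g : PS) → (f ⊛ g) (suc n) ≡ (f ⊛ shift g) n + f (suc n) * g 0
  ⊛-unfoldʳ n f g = cong₂ _+_
    (sumTo-cong n (λ k k≤n → cong (λ m → f k * g m) (ℕP.+-∸-assoc 1 k≤n)))
    (cong (λ m → f (suc n) * g m) (ℕP.n∸n≡0 n))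

  ⊛-cong : ∀ {f f′ g g′} → f ≈ f′ → g ≈ g′ → f ⊛ g ≈ f′ ⊛ g′
  ⊛-cong f≈f′ g≈g′ n = sumTo-cong n (λ k _ → cong₂ _*_ (f≈f′ k) (g≈g′ (n ∸ k)))

  ⊛-comm : ∀ f g → f ⊛ g ≈ g ⊛ f
  ⊛-comm f g zero    = ℤP.*-comm (f 0) (g 0)
  ⊛-comm f g (suc n) = begin
    (f ⊛ g) (suc n)                 ≡⟨ ⊛-unfoldˡ n f g ⟩
    f 0 * g (suc n) + (shift f ⊛ g) n ≡⟨ cong₂ _+_ (ℤP.*-comm (f 0) _) (⊛-comm (shift f) g n) ⟩
    g (suc n) * f 0 + (g ⊛ shift f) n ≡⟨ ℤP.+-comm (g (suc n) * f 0) _ ⟩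
    (g ⊛ shift f) n + g (suc n) * f 0 ≡⟨ ⊛-unfoldʳ n g f ⟨
    (g ⊛ f) (suc n)                 ∎

  ⊛-distribˡ : ∀ f g h → f ⊛ (g ⊕ h) ≈ f ⊛ g ⊕ f ⊛ h
  ⊛-distribˡ f g h n =
    trans (sumTo-cong n (λ k _ → ℤP.*-distribˡ-+ (f k) _ _)) (sumTo-+ n _ _)

  ⊛-distribʳ : ∀ f g h → (g ⊕ h) ⊛ f ≈ g ⊛ f ⊕ h ⊛ f
  ⊛-distribʳ f g h n = begin
    ((g ⊕ h) ⊛ f) n         ≡⟨ ⊛-comm (g ⊕ h) f n ⟩
    (f ⊛ (g ⊕ h)) n         ≡⟨ ⊛-distribˡ f g h n ⟩
    (f ⊛ g) n + (f ⊛ h) n   ≡⟨ cong₂ _+_ (⊛-comm f g n) (⊛-comm f h n) ⟩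
    (g ⊛ f) n + (h ⊛ f) n   ∎

  ⊛-scaleˡ : ∀ c (f g : PS) → (λ k → c * f k) ⊛ g ≈ (λ k → c * (f ⊛ g) k)
  ⊛-scaleˡ c f g n = trans (sumTo-cong n (λ k _ → ℤP.*-assoc c (f k) _)) (sumTo-*ˡ n c _)

  ⊛-zeroˡ : ∀ g → 𝟘 ⊛ g ≈ 𝟘
  ⊛-zeroˡ g n = trans (sumTo-zero n (λ k → trans (cong (_* g (n ∸ k)) (const-zero k))
                                                  (ℤP.*-zeroˡ (g (n ∸ k)))))
                      (sym (const-zero n))

  const-⊛ : ∀ c f → const c ⊛ f ≈ (λ n → c * f n)
  const-⊛ c f zero    = refl
  const-⊛ c f (suc n) = begin
    (const c ⊛ f) (suc n)                    ≡⟨ ⊛-unfoldˡ n (const c) f ⟩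
    c * f (suc n) + (shift (const c) ⊛ f) n   ≡⟨ cong (_+_ (c * f (suc n))) shifted-const-vanishes ⟩
    c * f (suc n) + 0ℤ                       ≡⟨ ℤP.+-identityʳ _ ⟩
    c * f (suc n)                            ∎
    where
    shifted-const-vanishes : (shift (const c) ⊛ f) n ≡ 0ℤ
    shifted-const-vanishes =
      trans (⊛-cong {g = f} (λ k → sym (const-zero k)) (λ _ → refl) n)
            (trans (⊛-zeroˡ f n) (const-zero n))

  ⊛-identityˡ : ∀ g → 𝟙 ⊛ g ≈ g
  ⊛-identityˡ g n = trans (const-⊛ 1ℤ g n) (ℤP.*-identityˡ (g n))

  -- Peeling off the constant term of the first factor reduces associativity at
  -- degree n + 1 to associativity at degree n.
  ⊛-assoc : ∀ f g h → (f ⊛ g) ⊛ h ≈ f ⊛ (g ⊛ h)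
  ⊛-assoc f g h zero    = ℤP.*-assoc (f 0) (g 0) (h 0)
  ⊛-assoc f g h (suc n) = begin
    ((f ⊛ g) ⊛ h) (suc n)
      ≡⟨ ⊛-unfoldˡ n (f ⊛ g) h ⟩
    f 0 * g 0 * h (suc n) + (shift (f ⊛ g) ⊛ h) n
      ≡⟨ cong (_+_ (f 0 * g 0 * h (suc n)))
              (⊛-cong {g = h} (λ k → ⊛-unfoldˡ k f g) (λ _ → refl) n) ⟩
    f 0 * g 0 * h (suc n) + (((λ k → f 0 * shift g k) ⊕ shift f ⊛ g) ⊛ h) n
      ≡⟨ cong (_+_ (f 0 * g 0 * h (suc n))) (⊛-distribʳ h (λ k → f 0 * shift g k) (shift f ⊛ g) n) ⟩
    f 0 * g 0 * h (suc n) + (((λ k → f 0 * shift g k) ⊛ h) n + (shift f ⊛ g ⊛ h) n)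
      ≡⟨ cong₂ (λ a b → f 0 * g 0 * h (suc n) + (a + b))
               (⊛-scaleˡ (f 0) (shift g) h n) (⊛-assoc (shift f) g h n) ⟩
    f 0 * g 0 * h (suc n) + (f 0 * (shift g ⊛ h) n + (shift f ⊛ (g ⊛ h)) n)
      ≡⟨ +-*-Solver.solve 5 (λ a b c d e → a :* b :* c :+ (a :* d :+ e) := a :* (b :* c :+ d) :+ e)
           refl (f 0) (g 0) (h (suc n)) ((shift g ⊛ h) n) ((shift f ⊛ (g ⊛ h)) n) ⟩
    f 0 * (g 0 * h (suc n) + (shift g ⊛ h) n) + (shift f ⊛ (g ⊛ h)) n
      ≡⟨ cong (λ x → f 0 * x + (shift f ⊛ (g ⊛ h)) n) (⊛-unfoldˡ n g h) ⟨
    f 0 * (g ⊛ h) (suc n) + (shift f ⊛ (g ⊛ h)) n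
      ≡⟨ ⊛-unfoldˡ n f (g ⊛ h) ⟨
    (f ⊛ (g ⊛ h)) (suc n) ∎
    where open +-*-Solver

  neg : PS → PS
  neg f n = - f n

  ps-commutativeRing : CommutativeRing 0ℓ 0ℓ
  ps-commutativeRing = record
    { Carrier = PS ; _≈_ = _≈_ ; _+_ = _⊕_ ; _*_ = _⊛_ ; -_ = neg
    ; 0# = 𝟘 ; 1# = 𝟙
    ; isCommutativeRing = record
      { isRing = record
        { +-isAbelianGroup = record
          { isGroup = record
            { isMonoid = record
              { isSemigroup = record
                { isMagma = record
                  { isEquivalence = record
                    { refl  = λ _ → refl
                    ; sym   = λ p n → sym (p n)
                    ; trans = λ p q n → trans (p n) (q n) }
                  ; ∙-cong = λ p q n → cong₂ _+_ (p n) (q n) }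
                ; assoc = λ f g h n → ℤP.+-assoc (f n) (g n) (h n) }
              ; identity = (λ f n → trans (cong (_+ f n) (const-zero n)) (ℤP.+-identityˡ (f n)))
                         , (λ f n → trans (cong (_+_ (f n)) (const-zero n)) (ℤP.+-identityʳ (f n))) }
            ; inverse = (λ f n → trans (ℤP.+-inverseˡ (f n)) (sym (const-zero n)))
                      , (λ f n → trans (ℤP.+-inverseʳ (f n)) (sym (const-zero n)))
            ; ⁻¹-cong = λ p n → cong -_ (p n) }
          ; comm = λ f g n → ℤP.+-comm (f n) (g n) }
        ; *-cong = ⊛-cong
        ; *-assoc = ⊛-assoc
        ; *-identity = ⊛-identityˡ , (λ f n → trans (⊛-comm f 𝟙 n) (⊛-identityˡ f n))
        ; distrib = ⊛-distribˡ , ⊛-distribʳ }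
      ; *-comm = ⊛-comm } }

  const-homomorphism : ℤ.+-*-rawRing -Raw-AlmostCommutative⟶ fromCommutativeRing ps-commutativeRing
  const-homomorphism = record
    { ⟦_⟧ = const
    ; +-homo = λ { a b zero → refl ; a b (suc n) → refl }
    ; *-homo = λ { a b zero    → refl
                 ; a b (suc n) → sym (trans (const-⊛ a (const b) (suc n)) (ℤP.*-zeroʳ a)) }
    ; -‿homo = λ { a zero → refl ; a (suc n) → refl }
    ; 0-homo = λ _ → refl
    ; 1-homo = λ _ → refl }

  const-≟ : ∀ a b → Maybe (const a ≈ const b)
  const-≟ a b with a ℤ.≟ b
  ... | yes refl = just (λ _ → refl)
  ... | no  _    = nothing

  module PS-Solver = Algebra.Solver.Ring ℤ.+-*-rawRing
                       (fromCommutativeRing ps-commutativeRing) const-homomorphism const-≟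

  module R = CommutativeRing ps-commutativeRing

  1:-_ : ∀ {m} → PS-Solver.Polynomial m → PS-Solver.Polynomial m
  1:- p = PS-Solver.con 1ℤ PS-Solver.:- p

  ⊖-cong : ∀ {f f′ g g′} → f ≈ f′ → g ≈ g′ → f ⊖ g ≈ f′ ⊖ g′
  ⊖-cong f≈f′ g≈g′ n = cong₂ _-_ (f≈f′ n) (g≈g′ n)

  ^ˢ-cong : ∀ {f g} → f ≈ g → ∀ j → f ^ˢ j ≈ g ^ˢ j
  ^ˢ-cong f≈g zero    = R.refl
  ^ˢ-cong f≈g (suc j) = ⊛-cong f≈g (^ˢ-cong f≈g j)

  ^ˢ-distrib-⊛ : ∀ f g j → (f ⊛ g) ^ˢ j ≈ f ^ˢ j ⊛ g ^ˢ j
  ^ˢ-distrib-⊛ f g zero    = R.sym (⊛-identityˡ 𝟙)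
  ^ˢ-distrib-⊛ f g (suc j) = R.trans (⊛-cong {f ⊛ g} R.refl (^ˢ-distrib-⊛ f g j))
    (PS-Solver.solve 4 (λ x y a b → (x :* y) :* (a :* b) := (x :* a) :* (y :* b))
                       R.refl f g (f ^ˢ j) (g ^ˢ j))
    where open PS-Solver using (_:*_; _:=_)

  z⊛-suc : ∀ f n → (z ⊛ f) (suc n) ≡ f n
  z⊛-suc f n = begin
    (z ⊛ f) (suc n)                   ≡⟨ ⊛-unfoldˡ n z f ⟩
    0ℤ * f (suc n) + (shift z ⊛ f) n   ≡⟨ ℤP.+-identityˡ _ ⟩
    (shift z ⊛ f) n                   ≡⟨ ⊛-cong {shift z} {𝟙} {f} shift-z≈𝟙 R.refl n ⟩
    (𝟙 ⊛ f) n                         ≡⟨ ⊛-identityˡ f n ⟩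
    f n                               ∎
    where
    shift-z≈𝟙 : shift z ≈ 𝟙
    shift-z≈𝟙 zero    = refl
    shift-z≈𝟙 (suc n) = refl

  z⊛-shift : ∀ {f} → f 0 ≡ 0ℤ → z ⊛ shift f ≈ f
  z⊛-shift     f₀≡0 zero    = sym f₀≡0
  z⊛-shift {f} f₀≡0 (suc n) = z⊛-suc (shift f) n

  z⊛-injective : ∀ {f g} → z ⊛ f ≈ z ⊛ g → f ≈ g
  z⊛-injective {f} {g} zf≈zg n = trans (sym (z⊛-suc f n)) (trans (zf≈zg (suc n)) (z⊛-suc g n))

  const⊛-injective : ∀ c .{{_ : ℤ.NonZero c}} {f g} → const c ⊛ f ≈ const c ⊛ g → f ≈ g
  const⊛-injective c {f} {g} cf≈cg n =
    ℤP.*-cancelˡ-≡ c (f n) (g n) (trans (sym (const-⊛ c f n)) (trans (cf≈cg n) (const-⊛ c g n)))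

module GeometricSeries where

  open PowerSeries
  open import Data.Nat using (zero; suc)
  open import Data.Integer as ℤ using (0ℤ; 1ℤ)
  import Relation.Binary.PropositionalEquality as Eq
  open import Relation.Binary.Reasoning.Setoid R.setoid
  open PS-Solver using (solve; _:+_; _:-_; _:*_; con; _:=_)

  geometric : PS
  geometric _ = 1ℤ

  geometric-unfold : 𝟙 ⊕ z ⊛ geometric ≈ geometric
  geometric-unfold zero    = Eq.refl
  geometric-unfold (suc n) = Eq.cong (ℤ._+_ 0ℤ) (z⊛-suc geometric n)

  geometric-inverse : (𝟙 ⊖ z) ⊛ geometric ≈ 𝟙
  geometric-inverse = begin
    (𝟙 ⊖ z) ⊛ geometric
      ≈⟨ solve 2 (λ x g → (1:- x) :* g := g :- x :* g) R.refl z geometric ⟩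
    geometric ⊖ z ⊛ geometric
      ≈⟨ ⊖-cong (R.sym geometric-unfold) R.refl ⟩
    𝟙 ⊕ z ⊛ geometric ⊖ z ⊛ geometric
      ≈⟨ solve 2 (λ x g → con 1ℤ :+ x :* g :- x :* g := con 1ℤ) R.refl z geometric ⟩
    𝟙 ∎

  1⊖z⊛-injective : ∀ {f g} → (𝟙 ⊖ z) ⊛ f ≈ (𝟙 ⊖ z) ⊛ g → f ≈ g
  1⊖z⊛-injective {f} {g} [1-z]f≈[1-z]g = begin
    f                                   ≈⟨ solve 1 (λ x → x := con 1ℤ :* x) R.refl f ⟩
    𝟙 ⊛ f                               ≈⟨ ⊛-cong {g = f} (R.sym geometric-inverse) R.refl ⟩
    (𝟙 ⊖ z) ⊛ geometric ⊛ f             ≈⟨ solve 3 (λ x y a → (1:- x) :* y :* a := y :* ((1:- x) :* a))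
                                                   R.refl z geometric f ⟩
    geometric ⊛ ((𝟙 ⊖ z) ⊛ f)           ≈⟨ ⊛-cong {geometric} R.refl [1-z]f≈[1-z]g ⟩
    geometric ⊛ ((𝟙 ⊖ z) ⊛ g)           ≈⟨ solve 3 (λ x y a → y :* ((1:- x) :* a) := (1:- x) :* y :* a)
                                                   R.refl z geometric g ⟩
    (𝟙 ⊖ z) ⊛ geometric ⊛ g             ≈⟨ ⊛-cong {g = g} geometric-inverse R.refl ⟩
    𝟙 ⊛ g                               ≈⟨ ⊛-identityˡ g ⟩
    g                                   ∎

module BivariateSeries where

  open PowerSeries
  open import Data.Nat using (zero; suc; _∸_)
  open import Data.Integer as ℤ using (0ℤ)
  import Data.Integer.Properties as ℤP
  open import Relation.Binary.PropositionalEquality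
    using (_≡_; refl; cong; cong₂; trans; module ≡-Reasoning)
  open ≡-Reasoning

  raise : BS → BS
  raise Y zero    = 𝟘
  raise Y (suc j) = Y j

  ι-cong : ∀ {f g} → f ≈ g → ι f ≈₂ ι g
  ι-cong f≈g zero    = f≈g
  ι-cong f≈g (suc j) = R.refl

  ≈₂-trans : ∀ {A B C} → A ≈₂ B → B ≈₂ C → A ≈₂ C
  ≈₂-trans A≈B B≈C j = R.trans (A≈B j) (B≈C j)

  ⊛₂-congˡ : ∀ {A B} Y → A ≈₂ B → A ⊛₂ Y ≈₂ B ⊛₂ Y
  ⊛₂-congˡ Y A≈B j n = sumTo-cong j (λ i _ → ⊛-cong {g = Y (j ∸ i)} (A≈B i) R.refl n)

  ⊛₂-degree-one : ∀ K Y → (∀ i → K (suc (suc i)) ≈ 𝟘) →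
                  ∀ j → (K ⊛₂ Y) (suc j) ≈ K 0 ⊛ Y (suc j) ⊕ K 1 ⊛ Y j
  ⊛₂-degree-one K Y K≈𝟘 j n = sumTo-two j (λ i → (K i ⊛ Y (suc j ∸ i)) n) vanishes
    where
    vanishes : ∀ i → (K (suc (suc i)) ⊛ Y (j ∸ suc i)) n ≡ 0ℤ
    vanishes i = trans (⊛-cong {g = Y (j ∸ suc i)} (K≈𝟘 i) R.refl n)
                       (trans (⊛-zeroˡ (Y (j ∸ suc i)) n) (const-zero n))

  ι-⊛₂ : ∀ f Y j → (ι f ⊛₂ Y) j ≈ f ⊛ Y j
  ι-⊛₂ f Y zero    n = refl
  ι-⊛₂ f Y (suc j) n = begin
    sumTo (suc j) (λ i → (ι f i ⊛ Y (suc j ∸ i)) n)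
      ≡⟨ sumTo-unfoldˡ j (λ i → (ι f i ⊛ Y (suc j ∸ i)) n) ⟩
    (f ⊛ Y (suc j)) n ℤ.+ sumTo j (λ i → (𝟘 ⊛ Y (j ∸ i)) n)
      ≡⟨ cong (ℤ._+_ ((f ⊛ Y (suc j)) n))
              (sumTo-zero j (λ i → trans (⊛-zeroˡ (Y (j ∸ i)) n) (const-zero n))) ⟩
    (f ⊛ Y (suc j)) n ℤ.+ 0ℤ
      ≡⟨ ℤP.+-identityʳ _ ⟩
    (f ⊛ Y (suc j)) n ∎

  u-⊛₂ : ∀ Y → u ⊛₂ Y ≈₂ raise Y
  u-⊛₂ Y zero    n = ⊛-zeroˡ (Y 0) n
  u-⊛₂ Y (suc j) n = begin
    sumTo (suc j) (λ i → (u i ⊛ Y (suc j ∸ i)) n)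
      ≡⟨ sumTo-unfoldˡ j (λ i → (u i ⊛ Y (suc j ∸ i)) n) ⟩
    (𝟘 ⊛ Y (suc j)) n ℤ.+ sumTo j (λ i → (u (suc i) ⊛ Y (j ∸ i)) n)
      ≡⟨ cong₂ ℤ._+_ (trans (⊛-zeroˡ (Y (suc j)) n) (const-zero n))
                     (⊛₂-congˡ Y u-suc j n) ⟩
    0ℤ ℤ.+ (ι 𝟙 ⊛₂ Y) j n
      ≡⟨ ℤP.+-identityˡ _ ⟩
    (ι 𝟙 ⊛₂ Y) j n
      ≡⟨ trans (ι-⊛₂ 𝟙 Y j n) (⊛-identityˡ (Y j) n) ⟩
    Y j n ∎
    where
    u-suc : (λ i → u (suc i)) ≈₂ ι 𝟙
    u-suc zero    = R.refl
    u-suc (suc i) = R.refl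

module LinearInU where

  open PowerSeries
  open BivariateSeries
  open import Data.Nat using (zero; suc)
  open import Data.Integer using (0ℤ)
  open import Relation.Binary.Reasoning.Setoid R.setoid
  open PS-Solver using (solve; _:+_; _:-_; :-_; _:*_; con; _:=_)

  module Linear (f g : PS) where

    M : BS
    M = ι f ⊖₂ u ⊛₂ ι g

    linear-zero : M 0 ≈ f
    linear-zero = begin
      f ⊖ (u ⊛₂ ι g) 0   ≈⟨ ⊖-cong (R.refl {f}) (u-⊛₂ (ι g) 0) ⟩
      f ⊖ 𝟘              ≈⟨ solve 1 (λ x → x :- con 0ℤ := x) R.refl f ⟩
      f                  ∎

    linear-one : M 1 ≈ neg g
    linear-one = begin
      𝟘 ⊖ (u ⊛₂ ι g) 1   ≈⟨ ⊖-cong (R.refl {𝟘}) (u-⊛₂ (ι g) 1) ⟩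
      𝟘 ⊖ g              ≈⟨ solve 1 (λ x → con 0ℤ :- x := :- x) R.refl g ⟩
      neg g              ∎

    linear-high : ∀ i → M (suc (suc i)) ≈ 𝟘
    linear-high i = begin
      𝟘 ⊖ (u ⊛₂ ι g) (suc (suc i))   ≈⟨ ⊖-cong (R.refl {𝟘}) (u-⊛₂ (ι g) (suc (suc i))) ⟩
      𝟘 ⊖ 𝟘                          ≈⟨ solve 0 (con 0ℤ :- con 0ℤ := con 0ℤ) R.refl ⟩
      𝟘                              ∎

    ⊛₂-linear : ∀ Y → (∀ j → f ⊛ Y (suc j) ≈ g ⊛ Y j) → M ⊛₂ Y ≈₂ ι (f ⊛ Y 0)
    ⊛₂-linear Y shift-eq zero    = ⊛-cong {g = Y 0} linear-zero R.refl
    ⊛₂-linear Y shift-eq (suc j) = begin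
      (M ⊛₂ Y) (suc j)               ≈⟨ ⊛₂-degree-one M Y linear-high j ⟩
      M 0 ⊛ Y (suc j) ⊕ M 1 ⊛ Y j    ≈⟨ R.+-cong (⊛-cong {g = Y (suc j)} linear-zero R.refl)
                                                 (⊛-cong {g = Y j} linear-one R.refl) ⟩
      f ⊛ Y (suc j) ⊕ neg g ⊛ Y j    ≈⟨ R.+-cong (shift-eq j) (R.refl {neg g ⊛ Y j}) ⟩
      g ⊛ Y j ⊕ neg g ⊛ Y j          ≈⟨ solve 2 (λ x y → x :* y :+ :- x :* y := con 0ℤ)
                                                R.refl g (Y j) ⟩
      𝟘                              ∎

  ι-⊛₂-linear : ∀ h f g → ι h ⊛₂ (ι f ⊖₂ u ⊛₂ ι g) ≈₂ ι (h ⊛ f) ⊖₂ u ⊛₂ ι (h ⊛ g)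
  ι-⊛₂-linear h f g j = R.trans (ι-⊛₂ h (Linear.M f g) j) (coefficient j)
    where
    open Linear
    coefficient : ∀ j → h ⊛ M f g j ≈ M (h ⊛ f) (h ⊛ g) j
    coefficient zero = begin
      h ⊛ M f g 0          ≈⟨ ⊛-cong {h} R.refl (linear-zero f g) ⟩
      h ⊛ f                ≈⟨ linear-zero (h ⊛ f) (h ⊛ g) ⟨
      M (h ⊛ f) (h ⊛ g) 0  ∎
    coefficient (suc zero) = begin
      h ⊛ M f g 1          ≈⟨ ⊛-cong {h} R.refl (linear-one f g) ⟩
      h ⊛ neg g            ≈⟨ solve 2 (λ x y → x :* (:- y) := :- (x :* y)) R.refl h g ⟩
      neg (h ⊛ g)          ≈⟨ linear-one (h ⊛ f) (h ⊛ g) ⟨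
      M (h ⊛ f) (h ⊛ g) 1  ∎
    coefficient (suc (suc i)) = begin
      h ⊛ M f g (suc (suc i))          ≈⟨ ⊛-cong {h} R.refl (linear-high f g i) ⟩
      h ⊛ 𝟘                            ≈⟨ solve 1 (λ x → x :* con 0ℤ := con 0ℤ) R.refl h ⟩
      𝟘                                ≈⟨ linear-high (h ⊛ f) (h ⊛ g) i ⟨
      M (h ⊛ f) (h ⊛ g) (suc (suc i))  ∎

module LastLetterCounts where

  open import Data.Nat using (ℕ; zero; suc; _+_; _≡ᵇ_)
  import Data.Nat.Properties as ℕP
  open import Data.Nat.Solver using (module +-*-Solver)
  open import Algebra.Properties.CommutativeSemigroup ℕP.+-commutativeSemigroup using (interchange)
  open import Data.Integer as ℤ using (+_)
  import Data.Integer.Properties as ℤP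
  open import Data.Bool using (Bool; true; false; _∧_; not)
  open import Data.List using (List; []; _∷_; _∷ʳ_; foldl; map; concatMap)
  open import Data.Nat.ListAction using (sum)
  open import Data.List.Properties using (foldl-∷ʳ)
  open import Relation.Nullary.Decidable using (⌊_⌋; isYes≗does)
  open import Relation.Binary.PropositionalEquality
    using (_≡_; _≢_; refl; cong; cong₂; sym; trans; module ≡-Reasoning)
  open import Data.Empty using (⊥-elim)
  open ≡-Reasoning

  ind : Bool → ℕ
  ind true  = 1
  ind false = 0

  Σ-letter : (Letter → ℕ) → ℕ
  Σ-letter f = f U + f H + f D

  Σ-letter-swap : ∀ (f : Letter → Letter → ℕ) →
                  Σ-letter (λ x → Σ-letter (f x)) ≡ Σ-letter (λ y → Σ-letter (λ x → f x y))
  Σ-letter-swap f = +-*-Solver.solve 9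
    (λ a b c d e g h i k → (a :+ b :+ c) :+ (d :+ e :+ g) :+ (h :+ i :+ k)
                         := (a :+ d :+ h) :+ (b :+ e :+ i) :+ (c :+ g :+ k))
    refl (f U U) (f U H) (f U D) (f H U) (f H H) (f H D) (f D U) (f D H) (f D D)
    where open +-*-Solver

  weigh : {A : Set} → (A → ℕ) → List A → ℕ
  weigh f xs = sum (map f xs)

  weigh-cong : {A : Set} {f g : A → ℕ} → (∀ x → f x ≡ g x) → ∀ xs → weigh f xs ≡ weigh g xs
  weigh-cong f≡g []       = refl
  weigh-cong f≡g (x ∷ xs) = cong₂ _+_ (f≡g x) (weigh-cong f≡g xs)

  weigh-zero : {A : Set} {f : A → ℕ} → (∀ x → f x ≡ 0) → ∀ xs → weigh f xs ≡ 0
  weigh-zero f≡0 []       = refl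
  weigh-zero f≡0 (x ∷ xs) = cong₂ _+_ (f≡0 x) (weigh-zero f≡0 xs)

  weigh-+ : {A : Set} (f g : A → ℕ) → ∀ xs → weigh (λ x → f x + g x) xs ≡ weigh f xs + weigh g xs
  weigh-+ f g []       = refl
  weigh-+ f g (x ∷ xs) = trans (cong (_+_ (f x + g x)) (weigh-+ f g xs))
                               (interchange (f x) (g x) (weigh f xs) (weigh g xs))

  weigh-Σ-letter : {A : Set} (f : Letter → A → ℕ) → ∀ xs →
                   weigh (λ a → Σ-letter (λ x → f x a)) xs ≡ Σ-letter (λ x → weigh (f x) xs)
  weigh-Σ-letter f xs = begin
    weigh (λ a → f U a + f H a + f D a) xs
      ≡⟨ weigh-+ (λ a → f U a + f H a) (f D) xs ⟩
    weigh (λ a → f U a + f H a) xs + weigh (f D) xs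
      ≡⟨ cong (_+ weigh (f D) xs) (weigh-+ (f U) (f H) xs) ⟩
    weigh (f U) xs + weigh (f H) xs + weigh (f D) xs ∎

  countBy≡weigh : {A : Set} (p : A → Bool) → ∀ xs → countBy p xs ≡ weigh (λ x → ind (p x)) xs
  countBy≡weigh p []       = refl
  countBy≡weigh p (x ∷ xs) with p x
  ... | true  = cong suc (countBy≡weigh p xs)
  ... | false = countBy≡weigh p xs

  weigh-words-suc : ∀ n (f : List Letter → ℕ) →
                    weigh f (words (suc n)) ≡ Σ-letter (λ x → weigh (λ w → f (x ∷ w)) (words n))
  weigh-words-suc n f = trans (extend (words n)) (weigh-Σ-letter (λ x w → f (x ∷ w)) (words n))
    where
    extend : ∀ ws → weigh f (concatMap (λ w → (U ∷ w) ∷ (H ∷ w) ∷ (D ∷ w) ∷ []) ws)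
                    ≡ weigh (λ w → Σ-letter (λ x → f (x ∷ w))) ws
    extend []       = refl
    extend (w ∷ ws) = begin
      f (U ∷ w) + (f (H ∷ w) + (f (D ∷ w) + weigh f (concatMap _ ws)))
        ≡⟨ cong (λ t → f (U ∷ w) + (f (H ∷ w) + (f (D ∷ w) + t))) (extend ws) ⟩
      f (U ∷ w) + (f (H ∷ w) + (f (D ∷ w) + weigh _ ws))
        ≡⟨ +-*-Solver.solve 4 (λ a b c t → a :+ (b :+ (c :+ t)) := a :+ b :+ c :+ t) refl
             (f (U ∷ w)) (f (H ∷ w)) (f (D ∷ w)) (weigh _ ws) ⟩
      Σ-letter (λ x → f (x ∷ w)) + weigh _ ws ∎
      where open +-*-Solver

  weigh-words-∷ʳ : ∀ n (f : List Letter → ℕ) →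
                   weigh f (words (suc n)) ≡ Σ-letter (λ x → weigh (λ w → f (w ∷ʳ x)) (words n))
  weigh-words-∷ʳ zero    f = weigh-words-suc zero f
  weigh-words-∷ʳ (suc n) f = begin
    weigh f (words (suc (suc n)))
      ≡⟨ weigh-words-suc (suc n) f ⟩
    Σ-letter (λ x → weigh (λ w → f (x ∷ w)) (words (suc n)))
      ≡⟨ cong₂ _+_ (cong₂ _+_ (weigh-words-∷ʳ n _) (weigh-words-∷ʳ n _)) (weigh-words-∷ʳ n _) ⟩
    Σ-letter (λ x → Σ-letter (λ y → weigh (λ w → f (x ∷ (w ∷ʳ y))) (words n)))
      ≡⟨ Σ-letter-swap (λ x y → weigh (λ w → f (x ∷ (w ∷ʳ y))) (words n)) ⟩
    Σ-letter (λ y → Σ-letter (λ x → weigh (λ w → f (x ∷ (w ∷ʳ y))) (words n)))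
      ≡⟨ cong₂ _+_ (cong₂ _+_ (sym (weigh-words-suc n _)) (sym (weigh-words-suc n _)))
                   (sym (weigh-words-suc n _)) ⟩
    Σ-letter (λ y → weigh (λ w → f (w ∷ʳ y)) (words (suc n))) ∎

  -- A state records the altitude and the last letter read; dead absorbs every word
  -- that leaves 𝓜. The empty word counts as ending in U, since any letter may follow U.
  data State : Set where
    dead : State
    at   : ℕ → Letter → State

  start : State
  start = at 0 U

  step : State → Letter → State
  step dead         _ = dead
  step (at k _)     U = at (suc k) U
  step (at k U)     H = at k H
  step (at k H)     H = at k H
  step (at k D)     H = dead
  step (at k H)     D = dead
  step (at zero _)  D = dead
  step (at (suc k) U) D = at k D
  step (at (suc k) D) D = at k D

  run : State → List Letter → State
  run = foldl step

  run-dead : ∀ w → run dead w ≡ dead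
  run-dead []      = refl
  run-dead (_ ∷ w) = run-dead w

  endsAt : ℕ → State → Bool
  endsAt j dead     = false
  endsAt j (at k _) = k ≡ᵇ j

  admissible : ℕ → Letter → List Letter → ℕ → Bool
  admissible k p w j =
    (prefixesNonneg (+ k) w ∧ not (containsPair D H (p ∷ w)) ∧ not (containsPair H D (p ∷ w)))
    ∧ ⌊ + k ℤ.+ level w ℤ.≟ + j ⌋

  admissible-∷ : ∀ k p x w j {k′} → + k ℤ.+ height x ≡ + k′ →
                 containsPair D H (p ∷ x ∷ w) ≡ containsPair D H (x ∷ w) →
                 containsPair H D (p ∷ x ∷ w) ≡ containsPair H D (x ∷ w) →
                 admissible k p (x ∷ w) j ≡ admissible k′ x w j
  admissible-∷ k p x w j k+x≡k′ DH HD
    rewrite sym (ℤP.+-assoc (+ k) (height x) (level w)) | k+x≡k′ | DH | HD = refl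

  ∧-false-absorbs : ∀ a b c → (a ∧ b ∧ false) ∧ c ≡ false
  ∧-false-absorbs false b     c = refl
  ∧-false-absorbs true  false c = refl
  ∧-false-absorbs true  true  c = refl

  run-dead-false : ∀ j w → false ≡ endsAt j (run dead w)
  run-dead-false j w = sym (cong (endsAt j) (run-dead w))

  run-admissible : ∀ k p w j → admissible k p w j ≡ endsAt j (run (at k p) w)
  run-admissible k p [] j =
    trans (cong (λ l → ⌊ l ℤ.≟ + j ⌋) (ℤP.+-identityʳ (+ k))) (isYes≗does (+ k ℤ.≟ + j))
  run-admissible k p (U ∷ w) j =
    trans (admissible-∷ k p U w j (cong +_ (ℕP.+-comm k 1)) (no-pair p) (no-pair′ p))
          (run-admissible (suc k) U w j)
    where
    no-pair : ∀ p → containsPair D H (p ∷ U ∷ w) ≡ containsPair D H (U ∷ w)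
    no-pair U = refl
    no-pair H = refl
    no-pair D = refl
    no-pair′ : ∀ p → containsPair H D (p ∷ U ∷ w) ≡ containsPair H D (U ∷ w)
    no-pair′ U = refl
    no-pair′ H = refl
    no-pair′ D = refl
  run-admissible k U (H ∷ w) j =
    trans (admissible-∷ k U H w j (ℤP.+-identityʳ (+ k)) refl refl) (run-admissible k H w j)
  run-admissible k H (H ∷ w) j =
    trans (admissible-∷ k H H w j (ℤP.+-identityʳ (+ k)) refl refl) (run-admissible k H w j)
  run-admissible k D (H ∷ w) j =
    trans (∧-false-absorbs (prefixesNonneg (+ k) (H ∷ w)) true _) (run-dead-false j w)
  run-admissible k H (D ∷ w) j =
    trans (∧-false-absorbs (prefixesNonneg (+ k) (D ∷ w)) (not (containsPair D H (D ∷ w))) _)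
          (run-dead-false j w)
  run-admissible zero    U (D ∷ w) j = run-dead-false j w
  run-admissible zero    D (D ∷ w) j = run-dead-false j w
  run-admissible (suc k) U (D ∷ w) j =
    trans (admissible-∷ (suc k) U D w j refl refl refl) (run-admissible k D w j)
  run-admissible (suc k) D (D ∷ w) j =
    trans (admissible-∷ (suc k) D D w j refl refl refl) (run-admissible k D w j)

  containsPair-U∷ : ∀ {X} Y w → X ≢ U → containsPair X Y (U ∷ w) ≡ containsPair X Y w
  containsPair-U∷ {U} Y w       X≢U = ⊥-elim (X≢U refl)
  containsPair-U∷ {H} Y []      _   = refl
  containsPair-U∷ {H} Y (_ ∷ _) _   = refl
  containsPair-U∷ {D} Y []      _   = refl
  containsPair-U∷ {D} Y (_ ∷ _) _   = refl

  accepts : ∀ w j → (inM w ∧ ⌊ level w ℤ.≟ + j ⌋) ≡ endsAt j (run start w)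
  accepts w j = begin
    (isMeander w ∧ not (containsPair D H w) ∧ not (containsPair H D w)) ∧ ⌊ level w ℤ.≟ + j ⌋
      ≡⟨ cong₂ (λ a b → (isMeander w ∧ not a ∧ not b) ∧ ⌊ level w ℤ.≟ + j ⌋)
               (sym (containsPair-U∷ H w λ ())) (sym (containsPair-U∷ D w λ ())) ⟩
    (isMeander w ∧ not (containsPair D H (U ∷ w)) ∧ not (containsPair H D (U ∷ w)))
      ∧ ⌊ level w ℤ.≟ + j ⌋
      ≡⟨ cong (λ l → (isMeander w ∧ not (containsPair D H (U ∷ w)) ∧ not (containsPair H D (U ∷ w)))
                     ∧ ⌊ l ℤ.≟ + j ⌋)
              (sym (ℤP.+-identityˡ (level w))) ⟩
    admissible 0 U w j
      ≡⟨ run-admissible 0 U w j ⟩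
    endsAt j (run start w) ∎

  sameLetter : Letter → Letter → Bool
  sameLetter U U = true
  sameLetter H H = true
  sameLetter D D = true
  sameLetter _ _ = false

  endsIn : ℕ → Letter → State → Bool
  endsIn j q dead     = false
  endsIn j q (at k p) = sameLetter q p ∧ (k ≡ᵇ j)

  runs : ℕ → (State → ℕ) → ℕ
  runs n t = weigh (λ w → t (run start w)) (words n)

  runs-cong : ∀ n {t t′ : State → ℕ} → (∀ s → t s ≡ t′ s) → runs n t ≡ runs n t′
  runs-cong n t≡t′ = weigh-cong (λ w → t≡t′ (run start w)) (words n)

  runs-suc : ∀ n t → runs (suc n) t ≡ Σ-letter (λ x → runs n (λ s → t (step s x)))
  runs-suc n t = trans (weigh-words-∷ʳ n _) (cong₂ _+_ (cong₂ _+_ (last U) (last H)) (last D))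
    where
    last : ∀ x → weigh (λ w → t (run start (w ∷ʳ x))) (words n) ≡ runs n (λ s → t (step s x))
    last x = weigh-cong (λ w → cong t (foldl-∷ʳ step start x w)) (words n)

  ending : Letter → ℕ → ℕ → ℕ
  ending q n j = runs n (λ s → ind (endsIn j q s))

  runs-zero : ∀ n {t : State → ℕ} → (∀ s → t s ≡ 0) → runs n t ≡ 0
  runs-zero n t≡0 = weigh-zero (λ w → t≡0 (run start w)) (words n)

  runs-+ : ∀ n (t t′ : State → ℕ) → runs n (λ s → t s + t′ s) ≡ runs n t + runs n t′
  runs-+ n t t′ = weigh-+ (λ w → t (run start w)) (λ w → t′ (run start w)) (words n)

  count≡runs : ∀ n j → count n j ≡ runs n (λ s → ind (endsAt j s))
  count≡runs n j =
    trans (countBy≡weigh _ (words n)) (weigh-cong (λ w → cong ind (accepts w j)) (words n))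

  endsAt-split : ∀ j s → ind (endsAt j s) ≡ Σ-letter (λ q → ind (endsIn j q s))
  endsAt-split j dead = refl
  endsAt-split j (at k U) with k ≡ᵇ j
  ... | true  = refl
  ... | false = refl
  endsAt-split j (at k H) with k ≡ᵇ j
  ... | true  = refl
  ... | false = refl
  endsAt-split j (at k D) with k ≡ᵇ j
  ... | true  = refl
  ... | false = refl

  count≡Σ-ending : ∀ n j → count n j ≡ Σ-letter (λ q → ending q n j)
  count≡Σ-ending n j = begin
    count n j                                                ≡⟨ count≡runs n j ⟩
    runs n (λ s → ind (endsAt j s))                          ≡⟨ runs-cong n (endsAt-split j) ⟩
    runs n (λ s → Σ-letter (λ q → ind (endsIn j q s)))
      ≡⟨ weigh-Σ-letter (λ q w → ind (endsIn j q (run start w))) (words n) ⟩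
    Σ-letter (λ q → ending q n j)                            ∎

  endsIn-step-other : ∀ j q x s → sameLetter q x ≡ false → endsIn j q (step s x) ≡ false
  endsIn-step-other j q x       dead            q≢x = refl
  endsIn-step-other j q U       (at k p)        q≢x = cong (_∧ (suc k ≡ᵇ j)) q≢x
  endsIn-step-other j q H       (at k U)        q≢x = cong (_∧ (k ≡ᵇ j)) q≢x
  endsIn-step-other j q H       (at k H)        q≢x = cong (_∧ (k ≡ᵇ j)) q≢x
  endsIn-step-other j q H       (at k D)        q≢x = refl
  endsIn-step-other j q D       (at k H)        q≢x = refl
  endsIn-step-other j q D       (at zero U)     q≢x = refl
  endsIn-step-other j q D       (at zero D)     q≢x = refl
  endsIn-step-other j q D       (at (suc k) U)  q≢x = cong (_∧ (k ≡ᵇ j)) q≢x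
  endsIn-step-other j q D       (at (suc k) D)  q≢x = cong (_∧ (k ≡ᵇ j)) q≢x

  runs-endsIn-step-other : ∀ n j q x → sameLetter q x ≡ false →
                           runs n (λ s → ind (endsIn j q (step s x))) ≡ 0
  runs-endsIn-step-other n j q x q≢x = runs-zero n (λ s → cong ind (endsIn-step-other j q x s q≢x))

  ending-suc : ∀ q n j → ending q (suc n) j ≡ runs n (λ s → ind (endsIn j q (step s q)))
  ending-suc U n j =
    trans (runs-suc n (λ s → ind (endsIn j U s)))
          (trans (cong₂ (λ a b → runs n (λ s → ind (endsIn j U (step s U))) + a + b)
                        (runs-endsIn-step-other n j U H refl) (runs-endsIn-step-other n j U D refl))
                 (trans (ℕP.+-identityʳ _) (ℕP.+-identityʳ _)))
  ending-suc H n j =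
    trans (runs-suc n (λ s → ind (endsIn j H s)))
          (trans (cong₂ (λ a b → a + runs n (λ s → ind (endsIn j H (step s H))) + b)
                        (runs-endsIn-step-other n j H U refl) (runs-endsIn-step-other n j H D refl))
                 (ℕP.+-identityʳ _))
  ending-suc D n j =
    trans (runs-suc n (λ s → ind (endsIn j D s)))
          (cong₂ (λ a b → a + b + runs n (λ s → ind (endsIn j D (step s D))))
                 (runs-endsIn-step-other n j D U refl) (runs-endsIn-step-other n j D H refl))

  ending-U-suc-zero : ∀ n → ending U (suc n) 0 ≡ 0
  ending-U-suc-zero n = trans (ending-suc U n 0) (runs-zero n climbs)
    where
    climbs : ∀ s → ind (endsIn 0 U (step s U)) ≡ 0
    climbs dead     = refl
    climbs (at _ _) = refl

  ending-U-suc-suc : ∀ n j → ending U (suc n) (suc j) ≡ count n j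
  ending-U-suc-suc n j =
    trans (ending-suc U n (suc j)) (trans (runs-cong n climbs) (sym (count≡runs n j)))
    where
    climbs : ∀ s → ind (endsIn (suc j) U (step s U)) ≡ ind (endsAt j s)
    climbs dead     = refl
    climbs (at _ _) = refl

  ending-H-suc : ∀ n j → ending H (suc n) j ≡ ending U n j + ending H n j
  ending-H-suc n j = trans (ending-suc H n j)
    (trans (runs-cong n stays) (runs-+ n (λ s → ind (endsIn j U s)) (λ s → ind (endsIn j H s))))
    where
    stays : ∀ s → ind (endsIn j H (step s H)) ≡ ind (endsIn j U s) + ind (endsIn j H s)
    stays dead     = refl
    stays (at k U) = sym (ℕP.+-identityʳ _)
    stays (at k H) = refl
    stays (at k D) = refl

  ending-D-suc : ∀ n j → ending D (suc n) j ≡ ending U n (suc j) + ending D n (suc j)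
  ending-D-suc n j = trans (ending-suc D n j)
    (trans (runs-cong n descends)
           (runs-+ n (λ s → ind (endsIn (suc j) U s)) (λ s → ind (endsIn (suc j) D s))))
    where
    descends : ∀ s → ind (endsIn j D (step s D)) ≡ ind (endsIn (suc j) U s) + ind (endsIn (suc j) D s)
    descends dead           = refl
    descends (at k H)       = refl
    descends (at zero U)    = refl
    descends (at zero D)    = refl
    descends (at (suc k) U) = sym (ℕP.+-identityʳ _)
    descends (at (suc k) D) = refl

module LastLetterSeries where

  open PowerSeries
  open LastLetterCounts
  open import Data.Nat as ℕ using (ℕ; zero; suc)
  open import Data.Integer as ℤ using (+_)
  import Data.Integer.Properties as ℤP
  open import Relation.Binary.PropositionalEquality
    using (_≡_; cong; cong₂; sym; trans; module ≡-Reasoning)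
  open ≡-Reasoning

  record LastLetterSystem (F : Letter → ℕ → PS) : Set where
    field
      U-zero : F U 0 ≈ 𝟙
      U-suc  : ∀ j → F U (suc j) ≈ z ⊛ (F U j ⊕ F H j ⊕ F D j)
      H-eq   : ∀ j → F H j ≈ z ⊛ (F U j ⊕ F H j)
      D-eq   : ∀ j → F D j ≈ z ⊛ (F U (suc j) ⊕ F D (suc j))

  +-Σ-letter : ∀ (f : Letter → ℕ) → + Σ-letter f ≡ + f U ℤ.+ + f H ℤ.+ + f D
  +-Σ-letter f = trans (ℤP.pos-+ (f U ℕ.+ f H) (f D)) (cong (ℤ._+ + f D) (ℤP.pos-+ (f U) (f H)))

  coefficient-suc : ∀ {f} g → f ≈ z ⊛ g → ∀ n → f (suc n) ≡ g n
  coefficient-suc g f≈zg n = trans (f≈zg (suc n)) (z⊛-suc g n)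

  module _ {F : Letter → ℕ → PS} (system : LastLetterSystem F) where

    open LastLetterSystem system

    ending≡coefficient : ∀ q n j → + ending q n j ≡ F q j n
    count≡coefficient : ∀ n j → + count n j ≡ (F U j ⊕ F H j ⊕ F D j) n

    count≡coefficient n j = begin
      + count n j                                       ≡⟨ cong +_ (count≡Σ-ending n j) ⟩
      + Σ-letter (λ q → ending q n j)                   ≡⟨ +-Σ-letter (λ q → ending q n j) ⟩
      + ending U n j ℤ.+ + ending H n j ℤ.+ + ending D n j
        ≡⟨ cong₂ ℤ._+_ (cong₂ ℤ._+_ (ending≡coefficient U n j) (ending≡coefficient H n j))
                       (ending≡coefficient D n j) ⟩
      (F U j ⊕ F H j ⊕ F D j) n                         ∎

    ending≡coefficient U zero    zero    = sym (U-zero 0)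
    ending≡coefficient U zero    (suc j) = sym (U-suc j 0)
    ending≡coefficient H zero    j       = sym (H-eq j 0)
    ending≡coefficient D zero    j       = sym (D-eq j 0)
    ending≡coefficient U (suc n) zero    =
      trans (cong +_ (ending-U-suc-zero n)) (sym (U-zero (suc n)))
    ending≡coefficient U (suc n) (suc j) = begin
      + ending U (suc n) (suc j)                        ≡⟨ cong +_ (ending-U-suc-suc n j) ⟩
      + count n j                                       ≡⟨ count≡coefficient n j ⟩
      (F U j ⊕ F H j ⊕ F D j) n
        ≡⟨ coefficient-suc (F U j ⊕ F H j ⊕ F D j) (U-suc j) n ⟨
      F U (suc j) (suc n)                               ∎
    ending≡coefficient H (suc n) j = begin
      + ending H (suc n) j                              ≡⟨ cong +_ (ending-H-suc n j) ⟩
      + (ending U n j ℕ.+ ending H n j)                 ≡⟨ ℤP.pos-+ (ending U n j) (ending H n j) ⟩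
      + ending U n j ℤ.+ + ending H n j
        ≡⟨ cong₂ ℤ._+_ (ending≡coefficient U n j) (ending≡coefficient H n j) ⟩
      (F U j ⊕ F H j) n                                 ≡⟨ coefficient-suc (F U j ⊕ F H j) (H-eq j) n ⟨
      F H j (suc n)                                     ∎
    ending≡coefficient D (suc n) j = begin
      + ending D (suc n) j                              ≡⟨ cong +_ (ending-D-suc n j) ⟩
      + (ending U n (suc j) ℕ.+ ending D n (suc j))
        ≡⟨ ℤP.pos-+ (ending U n (suc j)) (ending D n (suc j)) ⟩
      + ending U n (suc j) ℤ.+ + ending D n (suc j)
        ≡⟨ cong₂ ℤ._+_ (ending≡coefficient U n (suc j)) (ending≡coefficient D n (suc j)) ⟩
      (F U (suc j) ⊕ F D (suc j)) n
        ≡⟨ coefficient-suc (F U (suc j) ⊕ F D (suc j)) (D-eq j) n ⟨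
      F D j (suc n)                                     ∎

    S≈Σ-series : ∀ j → S j ≈ F U j ⊕ F H j ⊕ F D j
    S≈Σ-series j n = count≡coefficient n j

module Kernel where

  open PowerSeries
  open GeometricSeries
  open LastLetterSeries
  open import Data.Nat using (ℕ; suc)
  open import Data.Integer as ℤ using (+_; 0ℤ; 1ℤ; -_)
  import Data.Integer.Properties as ℤP
  import Relation.Binary.PropositionalEquality as Eq
  open import Relation.Binary.Reasoning.Setoid R.setoid
  open PS-Solver using (solve; _:+_; _:-_; _:*_; _:^_; con; _:=_)

  A : PS
  A = 𝟙 ⊖ z ⊕ z ^ˢ 3

  quadratic : PS → PS
  quadratic f = z ⊛ f ⊛ f ⊖ A ⊛ f ⊕ z ⊛ (𝟙 ⊖ z)

  quadratic-cong : ∀ {f g} → f ≈ g → quadratic f ≈ quadratic g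
  quadratic-cong {f} {g} f≈g n =
    Eq.cong (ℤ._+ (z ⊛ (𝟙 ⊖ z)) n)
            (Eq.cong₂ ℤ._-_ (⊛-cong {z ⊛ f} (⊛-cong {z} R.refl f≈g) f≈g n) (⊛-cong {A} R.refl f≈g n))

  quadratic-constant : ∀ f → quadratic f 0 Eq.≡ - f 0
  quadratic-constant f =
    Eq.trans (ℤP.+-identityʳ _) (Eq.trans (ℤP.+-identityˡ _) (Eq.cong -_ (ℤP.*-identityˡ (f 0))))

  module Root (W r : PS) (W²≈P : W ⊛ W ≈ P) (2zr≈A⊖W : const (+ 2) ⊛ z ⊛ r ≈ A ⊖ W) where

    -- Completing the square: 4z · quadratic r = (2zr − A)² − P, because A² − 4z²(1 − z) = P.
    r-root : quadratic r ≈ 𝟘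
    r-root = z⊛-injective (const⊛-injective (+ 4) (begin
      const (+ 4) ⊛ (z ⊛ quadratic r)
        ≈⟨ solve 2 (λ x y →
             let a = con 1ℤ :- x :+ x :^ 3
                 p = (con 1ℤ :+ x :- con (+ 2) :* x :^ 2 :- x :^ 3)
                   :* (con 1ℤ :- con (+ 3) :* x :+ con (+ 2) :* x :^ 2 :- x :^ 3)
             in con (+ 4) :* (x :* (x :* y :* y :- a :* y :+ x :* (1:- x)))
                := (con (+ 2) :* x :* y :- a) :* (con (+ 2) :* x :* y :- a) :- p)
             R.refl z r ⟩
      (const (+ 2) ⊛ z ⊛ r ⊖ A) ⊛ (const (+ 2) ⊛ z ⊛ r ⊖ A) ⊖ P
        ≈⟨ ⊖-cong (⊛-cong (⊖-cong 2zr≈A⊖W (R.refl {A})) (⊖-cong 2zr≈A⊖W (R.refl {A}))) R.refl ⟩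
      (A ⊖ W ⊖ A) ⊛ (A ⊖ W ⊖ A) ⊖ P
        ≈⟨ ⊖-cong (solve 2 (λ a w → (a :- w :- a) :* (a :- w :- a) := w :* w) R.refl A W) R.refl ⟩
      W ⊛ W ⊖ P
        ≈⟨ ⊖-cong W²≈P R.refl ⟩
      P ⊖ P
        ≈⟨ solve 2 (λ p x → p :- p := con (+ 4) :* (x :* con 0ℤ)) R.refl P z ⟩
      const (+ 4) ⊛ (z ⊛ 𝟘) ∎))

    r-constant : r 0 Eq.≡ 0ℤ
    r-constant = Eq.trans (Eq.sym (ℤP.neg-involutive (r 0)))
                          (Eq.cong -_ (Eq.trans (Eq.sym (quadratic-constant r)) (r-root 0)))

    ρ : PS
    ρ = shift r

    zρ≈r : z ⊛ ρ ≈ r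
    zρ≈r = z⊛-shift r-constant

    ρ-quadratic : (𝟙 ⊖ z) ⊛ (ρ ⊖ 𝟙) ≈ z ⊛ z ⊛ ρ ⊛ (ρ ⊖ z)
    ρ-quadratic = z⊛-injective (begin
      z ⊛ ((𝟙 ⊖ z) ⊛ (ρ ⊖ 𝟙))
        ≈⟨ solve 2 (λ x p →
             let a = con 1ℤ :- x :+ x :^ 3
                 zp = x :* p
             in x :* ((1:- x) :* (p :- con 1ℤ))
                := x :* (x :* x :* p :* (p :- x)) :- (x :* zp :* zp :- a :* zp :+ x :* (1:- x)))
             R.refl z ρ ⟩
      z ⊛ (z ⊛ z ⊛ ρ ⊛ (ρ ⊖ z)) ⊖ quadratic (z ⊛ ρ)
        ≈⟨ ⊖-cong (R.refl {z ⊛ (z ⊛ z ⊛ ρ ⊛ (ρ ⊖ z))}) (R.trans (quadratic-cong zρ≈r) r-root) ⟩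
      z ⊛ (z ⊛ z ⊛ ρ ⊛ (ρ ⊖ z)) ⊖ 𝟘
        ≈⟨ solve 1 (λ y → y :- con 0ℤ := y) R.refl (z ⊛ (z ⊛ z ⊛ ρ ⊛ (ρ ⊖ z))) ⟩
      z ⊛ (z ⊛ z ⊛ ρ ⊛ (ρ ⊖ z)) ∎)

    T : PS
    T = z ⊛ ρ ⊛ geometric

    [1⊖z]T≈r : (𝟙 ⊖ z) ⊛ T ≈ r
    [1⊖z]T≈r = begin
      (𝟙 ⊖ z) ⊛ T
        ≈⟨ solve 3 (λ x p g → (1:- x) :* (x :* p :* g) := x :* p :* ((1:- x) :* g))
                   R.refl z ρ geometric ⟩
      z ⊛ ρ ⊛ ((𝟙 ⊖ z) ⊛ geometric)
        ≈⟨ ⊛-cong {z ⊛ ρ} R.refl geometric-inverse ⟩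
      z ⊛ ρ ⊛ 𝟙
        ≈⟨ R.*-identityʳ (z ⊛ ρ) ⟩
      z ⊛ ρ
        ≈⟨ zρ≈r ⟩
      r ∎

    -- Multiplied by (1 − z)², this is ρ-quadratic.
    D-factor-equation : (ρ ⊖ 𝟙) ⊛ geometric ≈ z ⊛ T ⊛ (𝟙 ⊕ (ρ ⊖ 𝟙) ⊛ geometric)
    D-factor-equation = 1⊖z⊛-injective (1⊖z⊛-injective (begin
      (𝟙 ⊖ z) ⊛ ((𝟙 ⊖ z) ⊛ ((ρ ⊖ 𝟙) ⊛ geometric))
        ≈⟨ solve 3 (λ x p g → (1:- x) :* ((1:- x) :* ((p :- con 1ℤ) :* g))
                            := (1:- x) :* (p :- con 1ℤ) :* ((1:- x) :* g)) R.refl z ρ geometric ⟩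
      (𝟙 ⊖ z) ⊛ (ρ ⊖ 𝟙) ⊛ ((𝟙 ⊖ z) ⊛ geometric)
        ≈⟨ ⊛-cong {(𝟙 ⊖ z) ⊛ (ρ ⊖ 𝟙)} R.refl geometric-inverse ⟩
      (𝟙 ⊖ z) ⊛ (ρ ⊖ 𝟙) ⊛ 𝟙
        ≈⟨ R.*-identityʳ _ ⟩
      (𝟙 ⊖ z) ⊛ (ρ ⊖ 𝟙)
        ≈⟨ ρ-quadratic ⟩
      z ⊛ z ⊛ ρ ⊛ (ρ ⊖ z)
        ≈⟨ solve 2 (λ x p → x :* x :* p :* (p :- x)
                          := x :* x :* p :* con 1ℤ :* ((1:- x) :+ (p :- con 1ℤ) :* con 1ℤ))
                   R.refl z ρ ⟩
      z ⊛ z ⊛ ρ ⊛ 𝟙 ⊛ ((𝟙 ⊖ z) ⊕ (ρ ⊖ 𝟙) ⊛ 𝟙)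
        ≈⟨ ⊛-cong (⊛-cong {z ⊛ z ⊛ ρ} R.refl geometric-inverse)
                  (R.+-cong (R.refl {𝟙 ⊖ z}) (⊛-cong {ρ ⊖ 𝟙} R.refl geometric-inverse)) ⟨
      z ⊛ z ⊛ ρ ⊛ ((𝟙 ⊖ z) ⊛ geometric) ⊛ ((𝟙 ⊖ z) ⊕ (ρ ⊖ 𝟙) ⊛ ((𝟙 ⊖ z) ⊛ geometric))
        ≈⟨ solve 3 (λ x p g →
               x :* x :* p :* ((1:- x) :* g) :* ((1:- x) :+ (p :- con 1ℤ) :* ((1:- x) :* g))
               := (1:- x) :* ((1:- x) :* (x :* (x :* p :* g) :* (con 1ℤ :+ (p :- con 1ℤ) :* g))))
                   R.refl z ρ geometric ⟩
      (𝟙 ⊖ z) ⊛ ((𝟙 ⊖ z) ⊛ (z ⊛ T ⊛ (𝟙 ⊕ (ρ ⊖ 𝟙) ⊛ geometric))) ∎))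

    -- Here ρ = r/z, geometric = 1/(1 − z) and T = r/(1 − z), so level-series j is the
    -- closed form (1/z) (r/(1 − z))^(j+1).
    ending-series : Letter → ℕ → PS
    ending-series U j = T ^ˢ j
    ending-series H j = z ⊛ geometric ⊛ T ^ˢ j
    ending-series D j = (ρ ⊖ 𝟙) ⊛ geometric ⊛ T ^ˢ j

    level-series : ℕ → PS
    level-series j = ρ ⊛ geometric ⊛ T ^ˢ j

    level-series-split : ∀ j →
      ending-series U j ⊕ ending-series H j ⊕ ending-series D j ≈ level-series j
    level-series-split j = begin
      T ^ˢ j ⊕ z ⊛ geometric ⊛ T ^ˢ j ⊕ (ρ ⊖ 𝟙) ⊛ geometric ⊛ T ^ˢ j
        ≈⟨ solve 4 (λ x p g t → t :+ x :* g :* t :+ (p :- con 1ℤ) :* g :* t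
                              := (con 1ℤ :+ x :* g) :* t :+ (p :- con 1ℤ) :* g :* t)
                   R.refl z ρ geometric (T ^ˢ j) ⟩
      (𝟙 ⊕ z ⊛ geometric) ⊛ T ^ˢ j ⊕ (ρ ⊖ 𝟙) ⊛ geometric ⊛ T ^ˢ j
        ≈⟨ R.+-cong (⊛-cong {g = T ^ˢ j} geometric-unfold R.refl)
                    (R.refl {(ρ ⊖ 𝟙) ⊛ geometric ⊛ T ^ˢ j}) ⟩
      geometric ⊛ T ^ˢ j ⊕ (ρ ⊖ 𝟙) ⊛ geometric ⊛ T ^ˢ j
        ≈⟨ solve 3 (λ p g t → g :* t :+ (p :- con 1ℤ) :* g :* t := p :* g :* t)
                   R.refl ρ geometric (T ^ˢ j) ⟩
      ρ ⊛ geometric ⊛ T ^ˢ j ∎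

    ending-system : LastLetterSystem ending-series
    ending-system = record { U-zero = R.refl ; U-suc = U-suc ; H-eq = H-eq ; D-eq = D-eq }
      where
      U-suc : ∀ j → T ^ˢ suc j ≈ z ⊛ (ending-series U j ⊕ ending-series H j ⊕ ending-series D j)
      U-suc j = begin
        T ⊛ T ^ˢ j
          ≈⟨ solve 4 (λ x p g t → x :* p :* g :* t := x :* (p :* g :* t))
                     R.refl z ρ geometric (T ^ˢ j) ⟩
        z ⊛ level-series j
          ≈⟨ ⊛-cong {z} R.refl (level-series-split j) ⟨
        z ⊛ (ending-series U j ⊕ ending-series H j ⊕ ending-series D j) ∎

      H-eq : ∀ j → z ⊛ geometric ⊛ T ^ˢ j ≈ z ⊛ (T ^ˢ j ⊕ z ⊛ geometric ⊛ T ^ˢ j)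
      H-eq j = begin
        z ⊛ geometric ⊛ T ^ˢ j
          ≈⟨ ⊛-cong {g = T ^ˢ j} (⊛-cong {z} R.refl geometric-unfold) R.refl ⟨
        z ⊛ (𝟙 ⊕ z ⊛ geometric) ⊛ T ^ˢ j
          ≈⟨ solve 3 (λ x g t → x :* (con 1ℤ :+ x :* g) :* t := x :* (t :+ x :* g :* t))
                     R.refl z geometric (T ^ˢ j) ⟩
        z ⊛ (T ^ˢ j ⊕ z ⊛ geometric ⊛ T ^ˢ j) ∎

      D-eq : ∀ j → (ρ ⊖ 𝟙) ⊛ geometric ⊛ T ^ˢ j
                 ≈ z ⊛ (T ^ˢ suc j ⊕ (ρ ⊖ 𝟙) ⊛ geometric ⊛ T ^ˢ suc j)
      D-eq j = begin
        (ρ ⊖ 𝟙) ⊛ geometric ⊛ T ^ˢ j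
          ≈⟨ ⊛-cong {g = T ^ˢ j} D-factor-equation R.refl ⟩
        z ⊛ T ⊛ (𝟙 ⊕ (ρ ⊖ 𝟙) ⊛ geometric) ⊛ T ^ˢ j
          ≈⟨ solve 4 (λ x y d t → x :* y :* (con 1ℤ :+ d) :* t := x :* (y :* t :+ d :* (y :* t)))
                     R.refl z T ((ρ ⊖ 𝟙) ⊛ geometric) (T ^ˢ j) ⟩
        z ⊛ (T ⊛ T ^ˢ j ⊕ (ρ ⊖ 𝟙) ⊛ geometric ⊛ (T ⊛ T ^ˢ j)) ∎

    S≈level-series : ∀ j → S j ≈ level-series j
    S≈level-series j = R.trans (S≈Σ-series ending-system j) (level-series-split j)

    level-series-closed : ∀ j → z ⊛ (𝟙 ⊖ z) ^ˢ suc j ⊛ level-series j ≈ r ^ˢ suc j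
    level-series-closed j = begin
      z ⊛ ((𝟙 ⊖ z) ⊛ (𝟙 ⊖ z) ^ˢ j) ⊛ (ρ ⊛ geometric ⊛ T ^ˢ j)
        ≈⟨ solve 5 (λ x p g a t → x :* ((1:- x) :* a) :* (p :* g :* t)
                                := x :* p :* ((1:- x) :* g) :* (a :* t))
                   R.refl z ρ geometric ((𝟙 ⊖ z) ^ˢ j) (T ^ˢ j) ⟩
      z ⊛ ρ ⊛ ((𝟙 ⊖ z) ⊛ geometric) ⊛ ((𝟙 ⊖ z) ^ˢ j ⊛ T ^ˢ j)
        ≈⟨ ⊛-cong (⊛-cong zρ≈r geometric-inverse) (R.sym (^ˢ-distrib-⊛ (𝟙 ⊖ z) T j)) ⟩
      r ⊛ 𝟙 ⊛ ((𝟙 ⊖ z) ⊛ T) ^ˢ j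
        ≈⟨ ⊛-cong (R.*-identityʳ r) (^ˢ-cong [1⊖z]T≈r j) ⟩
      r ⊛ r ^ˢ j ∎

    level-series-suc : ∀ j → z ⊛ (𝟙 ⊖ z) ⊛ level-series (suc j) ≈ z ⊛ r ⊛ level-series j
    level-series-suc j = begin
      z ⊛ (𝟙 ⊖ z) ⊛ (ρ ⊛ geometric ⊛ (T ⊛ T ^ˢ j))
        ≈⟨ solve 4 (λ x y s t → x :* (1:- x) :* (y :* (s :* t)) := x :* ((1:- x) :* s) :* (y :* t))
                   R.refl z (ρ ⊛ geometric) T (T ^ˢ j) ⟩
      z ⊛ ((𝟙 ⊖ z) ⊛ T) ⊛ level-series j
        ≈⟨ ⊛-cong {g = level-series j} (⊛-cong {z} R.refl [1⊖z]T≈r) R.refl ⟩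
      z ⊛ r ⊛ level-series j ∎

    S-level : ∀ j → z ⊛ (𝟙 ⊖ z) ^ˢ suc j ⊛ S j ≈ r ^ˢ suc j
    S-level j =
      R.trans (⊛-cong {z ⊛ (𝟙 ⊖ z) ^ˢ suc j} R.refl (S≈level-series j)) (level-series-closed j)

    S-excursion : z ⊛ (𝟙 ⊖ z) ⊛ S 0 ≈ r
    S-excursion = begin
      z ⊛ (𝟙 ⊖ z) ⊛ S 0
        ≈⟨ ⊛-cong {g = S 0} (⊛-cong {z} R.refl (R.*-identityʳ (𝟙 ⊖ z))) R.refl ⟨
      z ⊛ (𝟙 ⊖ z) ^ˢ 1 ⊛ S 0          ≈⟨ S-level 0 ⟩
      r ⊛ 𝟙                           ≈⟨ R.*-identityʳ r ⟩
      r                               ∎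

    S-shift : ∀ j → z ⊛ (𝟙 ⊖ z) ⊛ S (suc j) ≈ z ⊛ r ⊛ S j
    S-shift j = begin
      z ⊛ (𝟙 ⊖ z) ⊛ S (suc j)         ≈⟨ ⊛-cong {z ⊛ (𝟙 ⊖ z)} R.refl (S≈level-series (suc j)) ⟩
      z ⊛ (𝟙 ⊖ z) ⊛ level-series (suc j) ≈⟨ level-series-suc j ⟩
      z ⊛ r ⊛ level-series j          ≈⟨ ⊛-cong {z ⊛ r} R.refl (S≈level-series j) ⟨
      z ⊛ r ⊛ S j                     ∎

open PowerSeries using (𝟙)
open BivariateSeries
open LinearInU
open Kernel using (module Root)

mainTheorem1 : (W r₁ : PS) → W 0 ≡ 1ℤ → W ⊛ W ≈ P
    → const (+ 2) ⊛ z ⊛ r₁ ≈ const 1ℤ ⊖ z ⊕ z ^ˢ 3 ⊖ W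
    → (ι z ⊛₂ (ι (const 1ℤ ⊖ z) ⊖₂ u ⊛₂ ι r₁) ⊛₂ S ≈₂ ι r₁)
      × (z ⊛ (const 1ℤ ⊖ z) ⊛ S 0 ≈ r₁)
      × ((j : ℕ) → z ⊛ ((const 1ℤ ⊖ z) ^ˢ suc j) ⊛ S j ≈ r₁ ^ˢ suc j)
mainTheorem1 W r₁ _ W²≈P 2zr₁≈A⊖W = kernel-equation , S-excursion , S-level
  where
  open Root W r₁ W²≈P 2zr₁≈A⊖W
  kernel-equation : ι z ⊛₂ (ι (𝟙 ⊖ z) ⊖₂ u ⊛₂ ι r₁) ⊛₂ S ≈₂ ι r₁
  kernel-equation =
    ≈₂-trans (⊛₂-congˡ S (ι-⊛₂-linear z (𝟙 ⊖ z) r₁))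
    (≈₂-trans (Linear.⊛₂-linear (z ⊛ (𝟙 ⊖ z)) (z ⊛ r₁) S S-shift)
              (ι-cong S-excursion))
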